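{- Let $n,k$ be integers with $1\le k<n/2$. Then $\mathrm{DGP}(n,k)$ is edge-transitive if and only if $A(n,k)\ne B(n,k)$.
   Context: $\mathrm{DGP}(n,k)$ is the canonical double cover of the generalized Petersen graph $\mathrm{GP}(n,k)$: vertex set $\{(u_i,j),(v_i,j): 0\le i\le n-1, j\in\{0,1\}\}$, edges $\{(u_i,j),(u_{i+1},1-j)\}$, $\{(v_i,j),(v_{i+k},1-j)\}$, and spokes $\{(u_i,j),(v_i,1-j)\}$ forming the set $\mathcal{S}$ (subscripts mod $n$). $A(n,k)=\mathrm{Aut}(\mathrm{DGP}(n,k))$ and $B(n,k)$ is the setwise stabilizer of $\mathcal{S}$ in $A(n,k)$. -}

module Defs where

open import Data.Nat using (ℕ; NonZero; _+_)
open import Data.Nat.DivMod using (_mod_)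
open import Data.Fin using (Fin; toℕ)
open import Data.Bool using (Bool; not)
open import Data.Product using (_×_; _,_; Σ)
open import Data.Sum using (_⊎_)
open import Relation.Binary.PropositionalEquality using (_≡_)

data Kind : Set where
  u v : Kind

-- Vertex (x_i , j) of DGP(n,k) is (x , i , j) with x ∈ {u,v}, i ∈ ℤ_n, j ∈ {0,1} (as Bool).
Vertex : ℕ → Set
Vertex n = Kind × Fin n × Bool

_⊕_ : {n : ℕ} .{{_ : NonZero n}} → Fin n → ℕ → Fin n
_⊕_ {n} i s = (toℕ i + s) mod n

module DGP (n k : ℕ) .{{_ : NonZero n}} where

  data SpokeArc : Vertex n → Vertex n → Set where
    spoke : ∀ i j → SpokeArc (u , i , j) (v , i , not j)

  -- all edges of DGP(n,k), each given with one orientation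
  data Arc : Vertex n → Vertex n → Set where
    outer : ∀ i j → Arc (u , i , j) (u , i ⊕ 1 , not j)
    inner : ∀ i j → Arc (v , i , j) (v , i ⊕ k , not j)
    spk   : ∀ {x y} → SpokeArc x y → Arc x y

  Adj : Vertex n → Vertex n → Set
  Adj x y = Arc x y ⊎ Arc y x

  IsSpoke : Vertex n → Vertex n → Set
  IsSpoke x y = SpokeArc x y ⊎ SpokeArc y x

  record Aut : Set where
    field
      to        : Vertex n → Vertex n
      from      : Vertex n → Vertex n
      from-to   : ∀ x → from (to x) ≡ x
      to-from   : ∀ x → to (from x) ≡ x
      preserves : ∀ x y → Adj x y → Adj (to x) (to y)
      reflects  : ∀ x y → Adj (to x) (to y) → Adj x y
  open Aut public

  StabilizesSpokes : Aut → Set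
  StabilizesSpokes σ =
    (∀ x y → IsSpoke x y → IsSpoke (to σ x) (to σ y)) ×
    (∀ x y → IsSpoke x y → IsSpoke (from σ x) (from σ y))

  EdgeTransitive : Set
  EdgeTransitive = ∀ x y x' y' → Adj x y → Adj x' y' →
    Σ Aut λ σ → (to σ x ≡ x' × to σ y ≡ y') ⊎ (to σ x ≡ y' × to σ y ≡ x')

-- The translations (x_i , j) ↦ (x_{i+a} , j xor b) are automorphisms, so up to automorphism the
-- edges form at most three classes: spokes, outer edges and inner edges; edge-transitivity says
-- they all fuse. If the spokes do not fuse with one cycle class, every automorphism maps spokes to
-- spokes: a spoke sent into the other cycle class would force the first cycle class, and hence its
-- vertex kind, to be preserved, yet the spoke has an endpoint of that kind. Conversely, an
-- automorphism sending a spoke onto an outer edge lies outside B(n,k). Constructively, turning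
-- the double negation of a fusion into a fusion needs decidability, which holds by exhaustive
-- search over pairs of maps on the finite vertex set.
module Submission where

open import Defs
open import Data.Bool using (Bool; true; false; not; _xor_; if_then_else_)
open import Data.Bool.Properties using (xor-assoc; xor-same; xor-identityʳ; not-distribˡ-xor)
import Data.Bool.Properties as Bool
open import Data.Empty using (⊥-elim)
open import Data.Fin using (Fin; toℕ)
open import Data.Fin.Properties using (toℕ-fromℕ<; toℕ-injective; toℕ<n)
import Data.Fin.Properties as Fin
open import Data.List using (List; []; _∷_; map; concatMap; cartesianProduct; allFin)
open import Data.List.Membership.Propositional using (_∈_; lose)
open import Data.List.Membership.Propositional.Properties
  using (∈-allFin; ∈-cartesianProduct⁺; ∈-map⁺; ∈-concatMap⁺)
import Data.List.Relation.Unary.All as All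
open import Data.List.Relation.Unary.Any using (Any; here; there; any?; satisfied)
open import Data.Nat using (ℕ; NonZero; _≤_; _<_; _*_; _+_; _∸_; _%_; >-nonZero⁻¹)
open import Data.Nat.DivMod using (_mod_; %-distribˡ-+; m%n%n≡m%n; m<n⇒m%n≡m; [m+n]%n≡m%n; m%n<n)
open import Data.Nat.Properties using (+-comm; +-assoc; m+[n∸m]≡n; m∸n+n≡m; <⇒≤)
open import Data.Product using (Σ; ∃; _×_; _,_; proj₁; swap)
open import Data.Product.Properties using (≡-dec)
open import Data.Sum using (_⊎_; inj₁; inj₂)
import Data.Sum as Sum
open import Function.Bundles using (_⇔_; mk⇔)
open import Relation.Binary.Definitions using (DecidableEquality)
open import Relation.Binary.PropositionalEquality
open import Relation.Nullary using (Dec; yes; no; does; ¬_)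
open import Relation.Nullary.Decidable using (map′; decidable-stable; _×-dec_; _⊎-dec_; _→-dec_)
open import Relation.Unary using (Decidable)

module FiniteSearch {A : Set} (_≟_ : DecidableEquality A) {elems : List A}
                    (complete : ∀ x → x ∈ elems) where

  ∀? : {P : A → Set} → Decidable P → Dec (∀ x → P x)
  ∀? P? = map′ (λ ps x → All.lookup ps (complete x)) (λ ps → All.tabulate (λ {x} _ → ps x))
               (All.all? P? elems)

  update : A → A → (A → A) → A → A
  update x y f x′ = if does (x′ ≟ x) then y else f x′

  endosOn : List A → List (A → A)
  endosOn []        = (λ x → x) ∷ []
  endosOn (x ∷ dom) = concatMap (λ y → map (update x y) (endosOn dom)) elems

  endosOn-complete : ∀ (f : A → A) dom →
                     ∃ λ g → g ∈ endosOn dom × (∀ x → x ∈ dom → g x ≡ f x)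
  endosOn-complete f [] = (λ x → x) , here refl , λ _ ()
  endosOn-complete f (x ∷ dom) =
    let g , g∈ , g≗f = endosOn-complete f dom in
    update x (f x) g ,
    ∈-concatMap⁺ (λ y → map (update x y) (endosOn dom))
      (lose (complete (f x)) (∈-map⁺ (update x (f x)) g∈)) ,
    agrees g g≗f
    where
      agrees : ∀ g → (∀ x′ → x′ ∈ dom → g x′ ≡ f x′) →
               ∀ x′ → x′ ∈ x ∷ dom → update x (f x) g x′ ≡ f x′
      agrees g g≗f x′ x′∈ with x′ ≟ x
      agrees g g≗f x′ x′∈          | yes refl = refl
      agrees g g≗f x′ (here refl)  | no x′≢x  = ⊥-elim (x′≢x refl)
      agrees g g≗f x′ (there x′∈) | no _     = g≗f x′ x′∈

  ∃-endo? : {P : (A → A) → Set} → (∀ {f g} → f ≗ g → P f → P g) →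
            Decidable P → Dec (∃ P)
  ∃-endo? {P} resp P? = map′ satisfied found (any? P? (endosOn elems))
    where
      found : ∃ P → Any P (endosOn elems)
      found (f , Pf) =
        let g , g∈ , g≗f = endosOn-complete f elems in
        lose g∈ (resp (λ x → sym (g≗f x (complete x))) Pf)

module _ {n : ℕ} .{{_ : NonZero n}} where

  toℕ-⊕ : ∀ (i : Fin n) s → toℕ (i ⊕ s) ≡ (toℕ i + s) % n
  toℕ-⊕ i s = toℕ-fromℕ< (m%n<n (toℕ i + s) n)

  [m%n+o]%n≡[m+o]%n : ∀ m o → (m % n + o) % n ≡ (m + o) % n
  [m%n+o]%n≡[m+o]%n m o = begin
    (m % n + o) % n         ≡⟨ %-distribˡ-+ (m % n) o n ⟩
    (m % n % n + o % n) % n ≡⟨ cong (λ t → (t + o % n) % n) (m%n%n≡m%n m n) ⟩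
    (m % n + o % n) % n     ≡⟨ %-distribˡ-+ m o n ⟨
    (m + o) % n             ∎
    where open ≡-Reasoning

  ⊕-+ : ∀ (i : Fin n) a b → (i ⊕ a) ⊕ b ≡ i ⊕ (a + b)
  ⊕-+ i a b = toℕ-injective (begin
    toℕ ((i ⊕ a) ⊕ b)         ≡⟨ toℕ-⊕ (i ⊕ a) b ⟩
    (toℕ (i ⊕ a) + b) % n     ≡⟨ cong (λ t → (t + b) % n) (toℕ-⊕ i a) ⟩
    ((toℕ i + a) % n + b) % n ≡⟨ [m%n+o]%n≡[m+o]%n (toℕ i + a) b ⟩
    (toℕ i + a + b) % n       ≡⟨ cong (_% n) (+-assoc (toℕ i) a b) ⟩
    (toℕ i + (a + b)) % n     ≡⟨ toℕ-⊕ i (a + b) ⟨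
    toℕ (i ⊕ (a + b))         ∎)
    where open ≡-Reasoning

  ⊕-swap : ∀ (i : Fin n) a b → (i ⊕ a) ⊕ b ≡ (i ⊕ b) ⊕ a
  ⊕-swap i a b = trans (⊕-+ i a b) (trans (cong (i ⊕_) (+-comm a b)) (sym (⊕-+ i b a)))

  ⊕-n : ∀ (i : Fin n) → i ⊕ n ≡ i
  ⊕-n i = toℕ-injective
    (trans (toℕ-⊕ i n) (trans ([m+n]%n≡m%n (toℕ i) n) (m<n⇒m%n≡m (toℕ<n i))))

  origin : Fin n
  origin = 0 mod n

  origin⊕toℕ : ∀ (i : Fin n) → origin ⊕ toℕ i ≡ i
  origin⊕toℕ i = toℕ-injective (begin
    toℕ (origin ⊕ toℕ i)     ≡⟨ toℕ-⊕ origin (toℕ i) ⟩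
    (toℕ origin + toℕ i) % n ≡⟨ cong (λ t → (t + toℕ i) % n) toℕ-origin ⟩
    toℕ i % n                ≡⟨ m<n⇒m%n≡m (toℕ<n i) ⟩
    toℕ i                    ∎)
    where
      open ≡-Reasoning
      toℕ-origin : toℕ origin ≡ 0
      toℕ-origin = trans (toℕ-fromℕ< (m%n<n 0 n)) (m<n⇒m%n≡m (>-nonZero⁻¹ n))

other : Kind → Kind
other u = v
other v = u

other-≢ : ∀ x → other x ≢ x
other-≢ u ()
other-≢ v ()

kind-dichotomy : ∀ y x → y ≡ x ⊎ y ≡ other x
kind-dichotomy u u = inj₁ refl
kind-dichotomy u v = inj₂ refl
kind-dichotomy v u = inj₂ refl
kind-dichotomy v v = inj₁ refl

_≟ᴷ_ : DecidableEquality Kind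
u ≟ᴷ u = yes refl
u ≟ᴷ v = no λ ()
v ≟ᴷ u = no λ ()
v ≟ᴷ v = yes refl

module EdgeOrbits (n k : ℕ) .{{_ : NonZero n}} where
  open DGP n k

  kind : Vertex n → Kind
  kind = proj₁

  Edge : Set
  Edge = Vertex n × Vertex n

  IsEdge : Edge → Set
  IsEdge (p , q) = Adj p q

  image : Aut → Edge → Edge
  image σ (p , q) = to σ p , to σ q

  mkAut : (f g : Vertex n → Vertex n) → (∀ x → g (f x) ≡ x) → (∀ x → f (g x) ≡ x) →
          (∀ x y → Adj x y → Adj (f x) (f y)) → (∀ x y → Adj x y → Adj (g x) (g y)) → Aut
  mkAut f g gf fg f-pres g-pres = record
    { to = f ; from = g ; from-to = gf ; to-from = fg ; preserves = f-pres
    ; reflects = λ x y a → subst₂ Adj (gf x) (gf y) (g-pres (f x) (f y) a) }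

  from-preserves : (σ : Aut) → ∀ x y → Adj x y → Adj (from σ x) (from σ y)
  from-preserves σ x y a =
    reflects σ _ _ (subst₂ Adj (sym (to-from σ x)) (sym (to-from σ y)) a)

  idᴬ : Aut
  idᴬ = mkAut (λ x → x) (λ x → x) (λ _ → refl) (λ _ → refl) (λ _ _ a → a) (λ _ _ a → a)

  inverse : Aut → Aut
  inverse σ = mkAut (from σ) (to σ) (to-from σ) (from-to σ) (from-preserves σ) (preserves σ)

  _∘ᴬ_ : Aut → Aut → Aut
  τ ∘ᴬ σ = mkAut (λ x → to τ (to σ x)) (λ x → from σ (from τ x))
    (λ x → trans (cong (from σ) (from-to τ (to σ x))) (from-to σ x))
    (λ x → trans (cong (to τ) (to-from σ (from τ x))) (to-from τ x))
    (λ x y a → preserves τ _ _ (preserves σ x y a))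
    (λ x y a → from-preserves σ _ _ (from-preserves τ x y a))

  translate : ℕ → Bool → Vertex n → Vertex n
  translate a b (x , i , j) = x , i ⊕ a , j xor b

  translate-step : ∀ a b x i j s →
                   (x , (i ⊕ a) ⊕ s , not (j xor b)) ≡ translate a b (x , i ⊕ s , not j)
  translate-step a b x i j s = cong₂ (λ i′ j′ → x , i′ , j′) (⊕-swap i a s) (not-distribˡ-xor j b)

  translate-arc : ∀ a b {p q} → Arc p q → Arc (translate a b p) (translate a b q)
  translate-arc a b (outer i j) = subst (Arc _) (translate-step a b u i j 1) (outer (i ⊕ a) (j xor b))
  translate-arc a b (inner i j) = subst (Arc _) (translate-step a b v i j k) (inner (i ⊕ a) (j xor b))
  translate-arc a b (spk (spoke i j)) =
    subst (Arc _) (cong (λ j′ → v , i ⊕ a , j′) (not-distribˡ-xor j b)) (spk (spoke (i ⊕ a) (j xor b)))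

  translate-adj : ∀ a b x y → Adj x y → Adj (translate a b x) (translate a b y)
  translate-adj a b _ _ = Sum.map (translate-arc a b) (translate-arc a b)

  translate-cancel : ∀ a a′ b w → a + a′ ≡ n → translate a′ b (translate a b w) ≡ w
  translate-cancel a a′ b (x , i , j) a+a′≡n = cong₂ (λ i′ j′ → x , i′ , j′)
    (trans (⊕-+ i a a′) (trans (cong (i ⊕_) a+a′≡n) (⊕-n i)))
    (trans (xor-assoc j b b) (trans (cong (j xor_) (xor-same b)) (xor-identityʳ j)))

  translation : Fin n → Bool → Aut
  translation c b = mkAut (translate (toℕ c) b) (translate (n ∸ toℕ c) b)
    (λ w → translate-cancel (toℕ c) (n ∸ toℕ c) b w (m+[n∸m]≡n (<⇒≤ (toℕ<n c))))
    (λ w → translate-cancel (n ∸ toℕ c) (toℕ c) b w (m∸n+n≡m (<⇒≤ (toℕ<n c))))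
    (translate-adj (toℕ c) b) (translate-adj (n ∸ toℕ c) b)

  Carries : (Vertex n → Vertex n) → Edge → Edge → Set
  Carries f (p , q) (p′ , q′) = (f p ≡ p′ × f q ≡ q′) ⊎ (f p ≡ q′ × f q ≡ p′)

  infix 4 _~_
  _~_ : Edge → Edge → Set
  e ~ e′ = Σ Aut λ σ → Carries (to σ) e e′

  ~-refl : ∀ {e} → e ~ e
  ~-refl = idᴬ , inj₁ (refl , refl)

  ~-sym : ∀ {e e′} → e ~ e′ → e′ ~ e
  ~-sym (σ , inj₁ (refl , refl)) = inverse σ , inj₁ (from-to σ _ , from-to σ _)
  ~-sym (σ , inj₂ (refl , refl)) = inverse σ , inj₂ (from-to σ _ , from-to σ _)

  ~-trans : ∀ {e e′ e″} → e ~ e′ → e′ ~ e″ → e ~ e″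
  ~-trans (σ , inj₁ (refl , refl)) (τ , m)                 = τ ∘ᴬ σ , m
  ~-trans (σ , inj₂ (refl , refl)) (τ , inj₁ (eq₁ , eq₂)) = τ ∘ᴬ σ , inj₂ (eq₂ , eq₁)
  ~-trans (σ , inj₂ (refl , refl)) (τ , inj₂ (eq₁ , eq₂)) = τ ∘ᴬ σ , inj₁ (eq₂ , eq₁)

  ~-swapʳ : ∀ {e e′} → e ~ e′ → e ~ swap e′
  ~-swapʳ (σ , m) = σ , Sum.swap m

  ~-image : ∀ σ e → e ~ image σ e
  ~-image σ e = σ , inj₁ (refl , refl)

  transfer : ∀ σ {e e′ e″} → e′ ~ e → e″ ~ image σ e → e′ ~ e″
  transfer σ {e} e′~e e″~σe = ~-trans e′~e (~-trans (~-image σ e) (~-sym e″~σe))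

  data EdgeClass : Set where
    spokes : EdgeClass
    cycle  : Kind → EdgeClass

  stride : Kind → ℕ
  stride u = 1
  stride v = k

  edgeAt : EdgeClass → Fin n → Bool → Edge
  edgeAt spokes    i j = (u , i , j) , (v , i , not j)
  edgeAt (cycle x) i j = (x , i , j) , (x , i ⊕ stride x , not j)

  base : EdgeClass → Edge
  base c = edgeAt c origin false

  InClass : EdgeClass → Edge → Set
  InClass spokes    (p , q) = IsSpoke p q
  InClass (cycle x) (p , q) = kind p ≡ x × kind q ≡ x

  edgeAt-isEdge : ∀ c i j → IsEdge (edgeAt c i j)
  edgeAt-isEdge spokes    i j = inj₁ (spk (spoke i j))
  edgeAt-isEdge (cycle u) i j = inj₁ (outer i j)
  edgeAt-isEdge (cycle v) i j = inj₁ (inner i j)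

  base~edgeAt : ∀ c i j → base c ~ edgeAt c i j
  base~edgeAt spokes i j = translation i j , inj₁ (at-origin , at-origin)
    where
      at-origin : ∀ {x : Kind} {b : Bool} → (x , origin ⊕ toℕ i , b) ≡ (x , i , b)
      at-origin {x} {b} = cong (λ i′ → x , i′ , b) (origin⊕toℕ i)
  base~edgeAt (cycle x) i j = translation i j , inj₁ (at-origin , at-stride)
    where
      at-origin : (x , origin ⊕ toℕ i , j) ≡ (x , i , j)
      at-origin = cong (λ i′ → x , i′ , j) (origin⊕toℕ i)
      at-stride : (x , (origin ⊕ stride x) ⊕ toℕ i , not j) ≡ (x , i ⊕ stride x , not j)
      at-stride = cong (λ i′ → x , i′ , not j)
        (trans (⊕-swap origin (stride x) (toℕ i)) (cong (_⊕ stride x) (origin⊕toℕ i)))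

  classify-arc : ∀ {p q} → Arc p q → Σ EdgeClass λ c → InClass c (p , q) × base c ~ (p , q)
  classify-arc (outer i j)       = cycle u , (refl , refl) , base~edgeAt (cycle u) i j
  classify-arc (inner i j)       = cycle v , (refl , refl) , base~edgeAt (cycle v) i j
  classify-arc (spk (spoke i j)) = spokes , inj₁ (spoke i j) , base~edgeAt spokes i j

  inClass-swap : ∀ c {p q} → InClass c (p , q) → InClass c (q , p)
  inClass-swap spokes    = Sum.swap
  inClass-swap (cycle x) = swap

  classify : ∀ {p q} → Adj p q → Σ EdgeClass λ c → InClass c (p , q) × base c ~ (p , q)
  classify (inj₁ a) = classify-arc a
  classify (inj₂ a) =
    let c , c∋qp , base~qp = classify-arc a in c , inClass-swap c c∋qp , ~-swapʳ base~qp

  spoke-isEdge : ∀ {p q} → IsSpoke p q → Adj p q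
  spoke-isEdge = Sum.map spk spk

  base~spoke : ∀ {p q} → IsSpoke p q → base spokes ~ (p , q)
  base~spoke (inj₁ (spoke i j)) = base~edgeAt spokes i j
  base~spoke (inj₂ (spoke i j)) = ~-swapʳ (base~edgeAt spokes i j)

  spoke-endpoint : ∀ {p q} → IsSpoke p q → ∀ x → kind p ≡ x ⊎ kind q ≡ x
  spoke-endpoint (inj₁ (spoke i j)) u = inj₁ refl
  spoke-endpoint (inj₁ (spoke i j)) v = inj₂ refl
  spoke-endpoint (inj₂ (spoke i j)) u = inj₂ refl
  spoke-endpoint (inj₂ (spoke i j)) v = inj₁ refl

  cycle-not-spoke : ∀ x {p q} → InClass (cycle x) (p , q) → ¬ IsSpoke p q
  cycle-not-spoke x (refl , ()) (inj₁ (spoke i j))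
  cycle-not-spoke x (refl , ()) (inj₂ (spoke i j))

  kind-preserved : ∀ x → base spokes ~ base (cycle (other x)) → ¬ base spokes ~ base (cycle x) →
                   ∀ σ w → kind w ≡ x → kind (to σ w) ≡ x
  kind-preserved x s~y s≁x σ (_ , i , j) refl
    with classify (preserves σ _ _ (edgeAt-isEdge (cycle x) i j))
  ... | spokes , _ , r = ⊥-elim (s≁x (~-sym (transfer σ (base~edgeAt (cycle x) i j) r)))
  ... | cycle y , (k-p , _) , r with kind-dichotomy y x
  ...   | inj₁ refl = k-p
  ...   | inj₂ refl = ⊥-elim (s≁x (~-trans s~y (~-sym (transfer σ (base~edgeAt (cycle x) i j) r))))

  spokes-preserved : ∀ x → ¬ base spokes ~ base (cycle x) →
                     ∀ σ p q → IsSpoke p q → IsSpoke (to σ p) (to σ q)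
  spokes-preserved x s≁x σ p q s with classify (preserves σ p q (spoke-isEdge s))
  ... | spokes , s′ , _ = s′
  ... | cycle y , (k-p , k-q) , r with kind-dichotomy y x | spoke-endpoint s x
  ...   | inj₁ refl | _ = ⊥-elim (s≁x (transfer σ (base~spoke s) r))
  ...   | inj₂ refl | inj₁ kp≡x = ⊥-elim (other-≢ x (trans (sym k-p)
    (kind-preserved x (transfer σ (base~spoke s) r) s≁x σ p kp≡x)))
  ...   | inj₂ refl | inj₂ kq≡x = ⊥-elim (other-≢ x (trans (sym k-q)
    (kind-preserved x (transfer σ (base~spoke s) r) s≁x σ q kq≡x)))

  stabilizes-spokes : ∀ x → ¬ base spokes ~ base (cycle x) → ∀ σ → StabilizesSpokes σ
  stabilizes-spokes x s≁x σ = spokes-preserved x s≁x σ , spokes-preserved x s≁x (inverse σ)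

  ¬spokes~outer : (∀ σ → StabilizesSpokes σ) → ¬ base spokes ~ base (cycle u)
  ¬spokes~outer stab (σ , m) =
    cycle-not-spoke u (both-outer m) (proj₁ (stab σ) _ _ (inj₁ (spoke origin false)))
    where
      both-outer : Carries (to σ) (base spokes) (base (cycle u)) →
                   InClass (cycle u) (image σ (base spokes))
      both-outer (inj₁ (eq₁ , eq₂)) = cong kind eq₁ , cong kind eq₂
      both-outer (inj₂ (eq₁ , eq₂)) = cong kind eq₁ , cong kind eq₂

  edgeTransitive : (∀ x → base spokes ~ base (cycle x)) → EdgeTransitive
  edgeTransitive fused x y x′ y′ a a′ =
    let c , _ , base~e = classify a ; c′ , _ , base~e′ = classify a′ in
    ~-trans (~-sym base~e) (~-trans (~-sym (spokes~ c)) (~-trans (spokes~ c′) base~e′))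
    where
      spokes~ : ∀ c → base spokes ~ base c
      spokes~ spokes    = ~-refl
      spokes~ (cycle x) = fused x

  _≟ᵛ_ : DecidableEquality (Vertex n)
  _≟ᵛ_ = ≡-dec _≟ᴷ_ (≡-dec Fin._≟_ Bool._≟_)

  vertices : List (Vertex n)
  vertices = cartesianProduct (u ∷ v ∷ []) (cartesianProduct (allFin n) (true ∷ false ∷ []))

  ∈-vertices : ∀ w → w ∈ vertices
  ∈-vertices (x , i , j) = ∈-cartesianProduct⁺ (∈-kinds x) (∈-cartesianProduct⁺ (∈-allFin i) (∈-bools j))
    where
      ∈-kinds : ∀ x → x ∈ u ∷ v ∷ []
      ∈-kinds u = here refl
      ∈-kinds v = there (here refl)
      ∈-bools : ∀ j → j ∈ true ∷ false ∷ []
      ∈-bools true  = here refl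
      ∈-bools false = there (here refl)

  arc? : ∀ p q → Dec (Arc p q)
  arc? (u , i , j) (u , i′ , j′) with i′ Fin.≟ i ⊕ 1 | j′ Bool.≟ not j
  ... | yes refl | yes refl = yes (outer i j)
  ... | no i′≢   | _        = no λ { (outer _ _) → i′≢ refl ; (spk ()) }
  ... | yes _    | no j′≢   = no λ { (outer _ _) → j′≢ refl ; (spk ()) }
  arc? (v , i , j) (v , i′ , j′) with i′ Fin.≟ i ⊕ k | j′ Bool.≟ not j
  ... | yes refl | yes refl = yes (inner i j)
  ... | no i′≢   | _        = no λ { (inner _ _) → i′≢ refl ; (spk ()) }
  ... | yes _    | no j′≢   = no λ { (inner _ _) → j′≢ refl ; (spk ()) }
  arc? (u , i , j) (v , i′ , j′) with i′ Fin.≟ i | j′ Bool.≟ not j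
  ... | yes refl | yes refl = yes (spk (spoke i j))
  ... | no i′≢   | _        = no λ { (spk (spoke _ _)) → i′≢ refl }
  ... | yes _    | no j′≢   = no λ { (spk (spoke _ _)) → j′≢ refl }
  arc? (v , i , j) (u , i′ , j′) = no λ { (spk ()) }

  adj? : ∀ p q → Dec (Adj p q)
  adj? p q = arc? p q ⊎-dec arc? q p

  open FiniteSearch _≟ᵛ_ ∈-vertices

  IsAutCarrying : Edge → Edge → (Vertex n → Vertex n) → (Vertex n → Vertex n) → Set
  IsAutCarrying e e′ f g =
    (∀ x → g (f x) ≡ x) × (∀ x → f (g x) ≡ x) ×
    (∀ x y → Adj x y → Adj (f x) (f y)) × (∀ x y → Adj (f x) (f y) → Adj x y) ×
    Carries f e e′

  isAutCarrying? : ∀ e e′ f g → Dec (IsAutCarrying e e′ f g)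
  isAutCarrying? (p , q) (p′ , q′) f g =
    ∀? (λ x → g (f x) ≟ᵛ x) ×-dec ∀? (λ x → f (g x) ≟ᵛ x) ×-dec
    ∀? (λ x → ∀? λ y → adj? x y →-dec adj? (f x) (f y)) ×-dec
    ∀? (λ x → ∀? λ y → adj? (f x) (f y) →-dec adj? x y) ×-dec
    ((f p ≟ᵛ p′ ×-dec f q ≟ᵛ q′) ⊎-dec (f p ≟ᵛ q′ ×-dec f q ≟ᵛ p′))

  isAutCarrying-resp : ∀ {e e′ f f′ g g′} → f ≗ f′ → g ≗ g′ →
                       IsAutCarrying e e′ f g → IsAutCarrying e e′ f′ g′
  isAutCarrying-resp {f = f} {f′} {g} {g′} f≗ g≗ (gf , fg , f-pres , f-refl , m) =
    (λ x → trans (sym (g≗ (f′ x))) (trans (cong g (sym (f≗ x))) (gf x))) ,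
    (λ x → trans (sym (f≗ (g′ x))) (trans (cong f (sym (g≗ x))) (fg x))) ,
    (λ x y a → subst₂ Adj (f≗ x) (f≗ y) (f-pres x y a)) ,
    (λ x y a → f-refl x y (subst₂ Adj (sym (f≗ x)) (sym (f≗ y)) a)) ,
    Sum.map (λ (eq₁ , eq₂) → trans (sym (f≗ _)) eq₁ , trans (sym (f≗ _)) eq₂)
            (λ (eq₁ , eq₂) → trans (sym (f≗ _)) eq₁ , trans (sym (f≗ _)) eq₂) m

  _~?_ : ∀ e e′ → Dec (e ~ e′)
  e ~? e′ = map′ toAut fromAut
    (∃-endo? (λ f≗ (g , c) → g , isAutCarrying-resp f≗ (λ _ → refl) c)
      (λ f → ∃-endo? (isAutCarrying-resp (λ _ → refl)) (isAutCarrying? e e′ f)))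
    where
      toAut : (∃ λ f → ∃ λ g → IsAutCarrying e e′ f g) → e ~ e′
      toAut (f , g , gf , fg , f-pres , f-refl , m) = record
        { to = f ; from = g ; from-to = gf ; to-from = fg
        ; preserves = f-pres ; reflects = f-refl } , m
      fromAut : e ~ e′ → ∃ λ f → ∃ λ g → IsAutCarrying e e′ f g
      fromAut (σ , m) = to σ , from σ , from-to σ , to-from σ , preserves σ , reflects σ , m

lemma5p6 : (n k : ℕ) .{{_ : NonZero n}} → 1 ≤ k → 2 * k < n →
    DGP.EdgeTransitive n k ⇔ (¬ (∀ (σ : DGP.Aut n k) → DGP.StabilizesSpokes n k σ))
lemma5p6 n k _ _ = mk⇔
  (λ et stab → ¬spokes~outer stab
    (et _ _ _ _ (edgeAt-isEdge spokes origin false) (edgeAt-isEdge (cycle u) origin false)))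
  (λ ¬stab → edgeTransitive λ x →
    decidable-stable (base spokes ~? base (cycle x)) (λ s≁x → ¬stab (stabilizes-spokes x s≁x)))
  where open EdgeOrbits n k
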